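{- Let $k\ge 4$ be an even integer and let $H$ be a blue line forest on $m>k/2$ vertices with exactly two components. Then $\tilde{r}_H(C_k,P_{m-k/2})\le k$.
   Context: Online Ramsey game: Builder and Painter play on the infinite complete graph $K_{\mathbb N}$. For a colored graph $H$ (each edge red or blue), the game $\tilde R_H(G_1,G_2)$ starts with a copy of $H$ already drawn and colored on the board. In each round Builder selects a previously unselected edge and Painter colors it red or blue. The game ends as soon as the graph of all colored edges contains a red copy of $G_1$ or a blue copy of $G_2$. $\tilde{r}_H(G_1,G_2)$ is the minimum number of rounds within which Builder can guarantee the end, both playing optimally. $C_k$ is the cycle on $k$ vertices, $P_j$ the path on $j$ vertices. A line forest is a graph every component of which is a path. -}

module Defs where

open import Data.Nat using (ℕ; zero; suc; _<_; _∸_)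
open import Data.List using (List; []; _∷_)
open import Data.List.Membership.Propositional using (_∈_)
open import Data.Product using (_×_; _,_; ∃)
open import Data.Sum using (_⊎_)
open import Relation.Nullary using (¬_)
open import Relation.Binary.PropositionalEquality using (_≡_; _≢_)

data Colour : Set where
  red blue : Colour

-- A board: the finite set of coloured edges of K_ℕ drawn so far,
-- as a list of (u , v , c) meaning edge {u,v} has colour c.
Board : Set
Board = List (ℕ × ℕ × Colour)

HasColour : Board → ℕ → ℕ → Colour → Set
HasColour B u v c = ((u , v , c) ∈ B) ⊎ ((v , u , c) ∈ B)

Selected : Board → ℕ → ℕ → Set
Selected B u v = ∃ λ c → HasColour B u v c

InjectiveBelow : ℕ → (ℕ → ℕ) → Set
InjectiveBelow n f = ∀ i j → i < n → j < n → f i ≡ f j → i ≡ j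

RedCycle : ℕ → Board → Set
RedCycle k B = ∃ λ (f : ℕ → ℕ) →
  InjectiveBelow k f
  × (∀ i → suc i < k → HasColour B (f i) (f (suc i)) red)
  × HasColour B (f (k ∸ 1)) (f 0) red

BluePath : ℕ → Board → Set
BluePath j B = ∃ λ (f : ℕ → ℕ) →
  InjectiveBelow j f
  × (∀ i → suc i < j → HasColour B (f i) (f (suc i)) blue)

Ended : ℕ → ℕ → Board → Set
Ended k j B = RedCycle k B ⊎ BluePath j B

-- WinsWithin k j n B : from position B, Builder can force the game
-- (red C_k or blue P_j) to end within n further rounds, whatever Painter does.
data WinsWithin (k j : ℕ) : ℕ → Board → Set where
  done : ∀ {n B} → Ended k j B → WinsWithin k j n B
  move : ∀ {n B} (u v : ℕ) → u ≢ v → ¬ Selected B u v →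
         (∀ c → WinsWithin k j n ((u , v , c) ∷ B)) →
         WinsWithin k j (suc n) B

bluePathEdges : List ℕ → Board
bluePathEdges [] = []
bluePathEdges (x ∷ []) = []
bluePathEdges (x ∷ y ∷ zs) = (x , y , blue) ∷ bluePathEdges (y ∷ zs)

-- Let n = k/2 and let the blue paths be x₀ … x_{a-1} and y₀ … y_{b-1}, so a + b = m.
-- If a < n or b < n, one of them already has at least m − n vertices. Otherwise Builder
-- draws the 2n-cycle y₀ x_{a-n} y₁ x_{a-n+1} … y_{n-1} x_{a-1}, which alternates between the
-- last n vertices of the first path and the first n vertices of the second. Each of its
-- edges joins some x_{a-n+u} to some y_v with v ≤ u + 1, so if Painter colours it blue then
-- x₀ … x_{a-n+u} y_v … y_{b-1} is a blue path on at least m − n vertices; if Painter colours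
-- all k edges red they form a red C_k.
module Submission where

open import Data.Nat using (ℕ; zero; suc; _≤_; _<_; _+_; _∸_; _/_; _%_; _*_; z≤n; s≤s; _≤?_; _<?_)
open import Data.Nat.Properties
open import Data.Nat.DivMod using (m≡m%n+[m/n]*n; m≥n⇒m/n>0)
open import Data.Nat.Tactic.RingSolver using (solve-∀)
open import Data.List using (List; []; _∷_; _++_; length; applyUpTo)
open import Data.List.Properties using (length-++; length-applyUpTo)
open import Data.List.Relation.Unary.All as All using (All; []; _∷_)
open import Data.List.Relation.Unary.All.Properties using (applyUpTo⁺₁; applyUpTo⁻)
open import Data.List.Relation.Unary.AllPairs using (_∷_)
open import Data.List.Relation.Unary.Any using (here; there)
open import Data.List.Relation.Unary.Unique.Propositional using (Unique)
open import Data.List.Relation.Binary.Subset.Propositional using (_⊆_)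
open import Data.List.Relation.Binary.Subset.Propositional.Properties using (⊆-refl)
open import Data.List.Membership.Propositional using (_∈_)
open import Data.List.Membership.Propositional.Properties using (∈-++⁺ˡ; ∈-++⁺ʳ)
open import Data.Product using (_×_; _,_; ∃; uncurry)
open import Data.Product.Properties using (≡-dec)
open import Data.Sum using (_⊎_; inj₁; inj₂)
import Data.Sum as Sum
open import Function using (_∘_)
open import Relation.Binary.Definitions using (DecidableEquality; tri<; tri≈; tri>)
open import Relation.Nullary using (Dec; yes; no; contradiction)
open import Relation.Nullary.Decidable using (_⊎-dec_; map′)
open import Relation.Binary.PropositionalEquality
open import Defs

_≟ᶜ_ : DecidableEquality Colour
red  ≟ᶜ red  = yes refl
red  ≟ᶜ blue = no λ ()
blue ≟ᶜ red  = no λ ()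
blue ≟ᶜ blue = yes refl

open import Data.List.Membership.DecPropositional (≡-dec _≟_ (≡-dec _≟_ _≟ᶜ_)) using (_∈?_)

HasColour-mono : ∀ {B B' u v c} → B ⊆ B' → HasColour B u v c → HasColour B' u v c
HasColour-mono B⊆B' = Sum.map B⊆B' B⊆B'

HasColour-sym : ∀ {B u v c} → HasColour B u v c → HasColour B v u c
HasColour-sym = Sum.swap

HasColour? : ∀ B u v c → Dec (HasColour B u v c)
HasColour? B u v c = ((u , v , c) ∈? B) ⊎-dec ((v , u , c) ∈? B)

Selected? : ∀ B u v → Dec (Selected B u v)
Selected? B u v = map′ colourOf byColour (HasColour? B u v red ⊎-dec HasColour? B u v blue)
  where
  colourOf : HasColour B u v red ⊎ HasColour B u v blue → Selected B u v
  colourOf (inj₁ h) = red , h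
  colourOf (inj₂ h) = blue , h
  byColour : Selected B u v → HasColour B u v red ⊎ HasColour B u v blue
  byColour (red  , h) = inj₁ h
  byColour (blue , h) = inj₂ h

Edge : Set
Edge = ℕ × ℕ

Coloured : Board → Colour → Edge → Set
Coloured B c (u , v) = HasColour B u v c

module _ {k j : ℕ} where

  WinsWithin-suc : ∀ {n B} → WinsWithin k j n B → WinsWithin k j (suc n) B
  WinsWithin-suc (done ended)               = done ended
  WinsWithin-suc (move u v u≢v fresh wins) = move u v u≢v fresh (WinsWithin-suc ∘ wins)

  -- An edge that is already coloured is skipped, which only saves a round.
  colourAll : ∀ (es : List Edge) B → All (uncurry _≢_) es →
              (∀ {B'} → B ⊆ B' → All (λ e → ∃ λ c → Coloured B' c e) es → Ended k j B') →
              WinsWithin k j (length es) B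
  colourAll []             B []             ended = done (ended ⊆-refl [])
  colourAll ((u , v) ∷ es) B (u≢v ∷ loopless) ended with Selected? B u v
  ... | yes (c , h) = WinsWithin-suc (colourAll es B loopless λ B⊆B' cs →
                        ended B⊆B' ((c , HasColour-mono B⊆B' h) ∷ cs))
  ... | no fresh = move u v u≢v fresh λ c → colourAll es ((u , v , c) ∷ B) loopless λ B⊆B' cs →
                     ended (B⊆B' ∘ there) ((c , inj₁ (B⊆B' (here refl))) ∷ cs)

cycleEdges : (ℕ → ℕ) → ℕ → List Edge
cycleEdges f k = (f (k ∸ 1) , f 0) ∷ applyUpTo (λ i → f i , f (suc i)) (k ∸ 1)

module _ {P : Edge → Set} (f : ℕ → ℕ) where

  All-cycleEdges⁺ : ∀ {k} → P (f (k ∸ 1) , f 0) → (∀ i → suc i < k → P (f i , f (suc i))) →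
                    All P (cycleEdges f k)
  All-cycleEdges⁺ {zero}  closing path = closing ∷ []
  All-cycleEdges⁺ {suc k} closing path = closing ∷ applyUpTo⁺₁ _ k (path _ ∘ s≤s)

  All-cycleEdges⁻ : ∀ {k} → All P (cycleEdges f k) →
                    P (f (k ∸ 1) , f 0) × (∀ i → suc i < k → P (f i , f (suc i)))
  All-cycleEdges⁻ {zero}  (closing ∷ _)    = closing , λ _ ()
  All-cycleEdges⁻ {suc k} (closing ∷ path) = closing , λ { _ (s≤s i<k) → applyUpTo⁻ _ k path i<k }

length-cycleEdges : ∀ f k → 1 ≤ k → length (cycleEdges f k) ≡ k
length-cycleEdges f (suc k) _ = cong suc (length-applyUpTo _ k)

redCycle : ∀ {k B f} → InjectiveBelow k f → All (Coloured B red) (cycleEdges f k) → RedCycle k B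
redCycle {f = f} f-inj reds with All-cycleEdges⁻ f reds
... | closing , path = f , f-inj , path , closing

redOrBlue : ∀ {X : Set} {B} (es : List Edge) → All (λ e → ∃ λ c → Coloured B c e) es →
            All (λ e → Coloured B blue e → X) es → All (Coloured B red) es ⊎ X
redOrBlue []       []                []            = inj₁ []
redOrBlue (_ ∷ es) ((red  , h) ∷ cs) (_ ∷ ifBlue) = Sum.map₁ (h ∷_) (redOrBlue es cs ifBlue)
redOrBlue (_ ∷ es) ((blue , h) ∷ cs) (ifBlue ∷ _) = inj₂ (ifBlue h)

forceRedCycle : ∀ {k j B₀} (f : ℕ → ℕ) → 2 ≤ k → InjectiveBelow k f →
                All (λ e → ∀ {B} → B₀ ⊆ B → Coloured B blue e → Ended k j B)
                    (cycleEdges f k) →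
                WinsWithin k j k B₀
forceRedCycle {k} {j} {B₀} f (s≤s (s≤s _)) f-inj blueEnds =
  subst (λ n → WinsWithin k j n B₀) (length-cycleEdges f k (s≤s z≤n))
    (colourAll (cycleEdges f k) B₀ (All-cycleEdges⁺ f closing≢ path≢) ended)
  where
  closing≢ : f (k ∸ 1) ≢ f 0
  closing≢ e with f-inj (k ∸ 1) 0 ≤-refl (s≤s z≤n) e
  ... | ()
  path≢ : ∀ i → suc i < k → f i ≢ f (suc i)
  path≢ i 1+i<k e = 1+n≢n (sym (f-inj i (suc i) (<-trans (n<1+n i) 1+i<k) 1+i<k e))
  ended : ∀ {B} → B₀ ⊆ B → All (λ e → ∃ λ c → Coloured B c e) (cycleEdges f k) →
          Ended k j B
  ended B₀⊆B coloured with redOrBlue _ coloured (All.map (λ ends → ends B₀⊆B) blueEnds)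
  ... | inj₁ reds      = inj₁ (redCycle f-inj reds)
  ... | inj₂ blueEnded = blueEnded

at : List ℕ → ℕ → ℕ
at []       _       = 0
at (x ∷ xs) zero    = x
at (x ∷ xs) (suc i) = at xs i

at-∈ : ∀ xs {i} → i < length xs → at xs i ∈ xs
at-∈ (x ∷ xs) {zero}  _         = here refl
at-∈ (x ∷ xs) {suc i} (s≤s i<n) = there (at-∈ xs i<n)

at-injective : ∀ {xs} → Unique xs → InjectiveBelow (length xs) (at xs)
at-injective {x ∷ xs} (_    ∷ _)    zero    zero    _         _         _ = refl
at-injective {x ∷ xs} (x∉xs ∷ _)    zero    (suc j) _         (s≤s j<n) e =
  contradiction e (All.lookup x∉xs (at-∈ xs j<n))
at-injective {x ∷ xs} (x∉xs ∷ _)    (suc i) zero    (s≤s i<n) _         e =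
  contradiction (sym e) (All.lookup x∉xs (at-∈ xs i<n))
at-injective {x ∷ xs} (_    ∷ uniq) (suc i) (suc j) (s≤s i<n) (s≤s j<n) e =
  cong suc (at-injective uniq i j i<n j<n e)

at-++ˡ : ∀ xs ys {i} → i < length xs → at (xs ++ ys) i ≡ at xs i
at-++ˡ (x ∷ xs) ys {zero}  _         = refl
at-++ˡ (x ∷ xs) ys {suc i} (s≤s i<n) = at-++ˡ xs ys i<n

at-++ʳ : ∀ xs ys i → at (xs ++ ys) (length xs + i) ≡ at ys i
at-++ʳ []       ys i = refl
at-++ʳ (x ∷ xs) ys i = at-++ʳ xs ys i

at∈bluePathEdges : ∀ xs {i} → suc i < length xs →
                   (at xs i , at xs (suc i) , blue) ∈ bluePathEdges xs
at∈bluePathEdges (x ∷ [])     (s≤s ())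
at∈bluePathEdges (x ∷ y ∷ zs) {zero}  _         = here refl
at∈bluePathEdges (x ∷ y ∷ zs) {suc i} (s≤s 1+i<n) = there (at∈bluePathEdges (y ∷ zs) 1+i<n)

data Half : ℕ → Set where
  even : ∀ u → Half (u + u)
  odd  : ∀ u → Half (suc (u + u))

half : ∀ t → Half t
half zero          = even 0
half (suc zero)    = odd 0
half (suc (suc t)) with half t
... | even u = subst Half (cong suc (+-suc u u)) (even (suc u))
... | odd u  = subst Half (cong (suc ∘ suc) (+-suc u u)) (odd (suc u))

m+m<n+n⇒m<n : ∀ {m n} → m + m < n + n → m < n
m+m<n+n⇒m<n {m} {n} m+m<n+n with m <? n
... | yes m<n = m<n
... | no  m≮n = contradiction m+m<n+n (≤⇒≯ (+-mono-≤ (≮⇒≥ m≮n) (≮⇒≥ m≮n)))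

module TwoPaths (xs ys : List ℕ) (uniq : Unique (xs ++ ys)) where

  a b m : ℕ
  a = length xs
  b = length ys
  m = a + b

  g : ℕ → ℕ
  g = at (xs ++ ys)

  B₀ : Board
  B₀ = bluePathEdges xs ++ bluePathEdges ys

  g-injective : InjectiveBelow m g
  g-injective = subst (λ n → InjectiveBelow n g) (length-++ xs) (at-injective uniq)

  g-edge : ∀ i → suc i < m → suc i ≢ a → (g i , g (suc i) , blue) ∈ B₀
  g-edge i 1+i<m 1+i≢a with <-cmp (suc i) a
  ... | tri≈ _ 1+i≡a _ = contradiction 1+i≡a 1+i≢a
  ... | tri< 1+i<a _ _ rewrite at-++ˡ xs ys (<-trans (n<1+n i) 1+i<a) | at-++ˡ xs ys 1+i<a
    = ∈-++⁺ˡ (at∈bluePathEdges xs 1+i<a)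
  ... | tri> _ _ a<1+i with m≤n⇒∃[o]m+o≡n (≤-pred a<1+i)
  ... | i' , refl rewrite sym (+-suc a i') | at-++ʳ xs ys i' | at-++ʳ xs ys (suc i')
    = ∈-++⁺ʳ (bluePathEdges xs) (at∈bluePathEdges ys (+-cancelˡ-< a (suc i') b 1+i<m))

  prefixPath : ∀ {j} → j ≤ a → BluePath j B₀
  prefixPath {j} j≤a =
    g ,
    (λ i i' i<j i'<j → g-injective i i' (<m i<j) (<m i'<j)) ,
    λ i 1+i<j → inj₁ (g-edge i (<m 1+i<j) (<⇒≢ (<-≤-trans 1+i<j j≤a)))
    where
    <m : ∀ {i} → i < j → i < m
    <m i<j = <-≤-trans i<j (≤-trans j≤a (m≤m+n a b))

  suffixPath : ∀ {j} → j ≤ b → BluePath j B₀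
  suffixPath {j} j≤b =
    (λ i → g (a + i)) ,
    (λ i i' i<j i'<j → +-cancelˡ-≡ a i i' ∘ g-injective (a + i) (a + i') (<m i<j) (<m i'<j)) ,
    λ i 1+i<j → inj₁ (subst (λ r → (g (a + i) , g r , blue) ∈ B₀) (sym (+-suc a i))
                        (g-edge (a + i) (subst (_< m) (+-suc a i) (<m 1+i<j)) (m≢1+m+n a ∘ sym)))
    where
    <m : ∀ {i} → i < j → a + i < m
    <m i<j = +-monoʳ-< a (<-≤-trans i<j j≤b)

  -- With r = p + 1 + D, the blue path x₀ … x_p y_{r-a} … y_{b-1} through a blue edge {x_p, y_{r-a}}.
  module _ {B} (B₀⊆B : B₀ ⊆ B) {p D j}
           (p<a : p < a) (a≤r : a ≤ suc (p + D)) (j+D≤m : j + D ≤ m)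
           (bridge : HasColour B (g p) (g (suc (p + D))) blue) where

    skip : ℕ → ℕ
    skip i with i ≤? p
    ... | yes _ = i
    ... | no  _ = i + D

    skip-≤ : ∀ {i} → i ≤ p → skip i ≡ i
    skip-≤ {i} i≤p with i ≤? p
    ... | yes _   = refl
    ... | no  i≰p = contradiction i≤p i≰p

    skip-> : ∀ {i} → p < i → skip i ≡ i + D
    skip-> {i} p<i with i ≤? p
    ... | yes i≤p = contradiction i≤p (<⇒≱ p<i)
    ... | no  _   = refl

    skip-<m : ∀ {i} → i < j → skip i < m
    skip-<m {i} i<j with i ≤? p
    ... | yes i≤p = <-≤-trans (s≤s i≤p) (≤-trans p<a (m≤m+n a b))
    ... | no  _   = <-≤-trans (+-monoˡ-< D i<j) j+D≤m

    skip-injective : ∀ {i i'} → skip i ≡ skip i' → i ≡ i'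
    skip-injective {i} {i'} e with i ≤? p | i' ≤? p
    ... | yes _   | yes _    = e
    ... | no  _   | no  _    = +-cancelʳ-≡ D i i' e
    ... | yes i≤p | no  i'≰p = contradiction (≤-trans (m≤m+n i' D) (subst (_≤ p) e i≤p)) i'≰p
    ... | no  i≰p | yes i'≤p = contradiction (≤-trans (m≤m+n i D) (subst (_≤ p) (sym e) i'≤p)) i≰p

    skip-edge : ∀ i → suc i < j → HasColour B (g (skip i)) (g (skip (suc i))) blue
    skip-edge i 1+i<j with <-cmp i p
    ... | tri< i<p _ _ rewrite skip-≤ (<⇒≤ i<p) | skip-≤ i<p =
      inj₁ (B₀⊆B (g-edge i (<-≤-trans 1+i<a (m≤m+n a b)) (<⇒≢ 1+i<a)))
      where
      1+i<a : suc i < a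
      1+i<a = ≤-<-trans i<p p<a
    ... | tri≈ _ refl _ rewrite skip-≤ (≤-refl {p}) | skip-> (n<1+n p) = bridge
    ... | tri> _ _ p<i rewrite skip-> p<i | skip-> (<-trans p<i (n<1+n i)) =
      inj₁ (B₀⊆B (g-edge (i + D) (<-≤-trans (+-monoˡ-< D 1+i<j) j+D≤m)
                   (>⇒≢ (s≤s (≤-trans a≤r (+-monoˡ-≤ D p<i))))))

    skipPath : BluePath j B
    skipPath =
      g ∘ skip ,
      (λ i i' i<j i'<j → skip-injective ∘ g-injective (skip i) (skip i') (skip-<m i<j) (skip-<m i'<j)) ,
      skip-edge

  module Zigzag (α n' : ℕ) (α+n≡a : α + suc n' ≡ a) (n≤b : suc n' ≤ b) where

    n K j : ℕ
    n = suc n'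
    K = n + n
    j = m ∸ n

    -- Positions in g of the cycle y₀ x_α y₁ x_{α+1} … y_{n-1} x_{α+n-1}.
    ix : ℕ → ℕ
    ix zero          = a
    ix (suc zero)    = α
    ix (suc (suc t)) = suc (ix t)

    ix-even : ∀ u → ix (u + u) ≡ a + u
    ix-even zero    = sym (+-identityʳ a)
    ix-even (suc u) rewrite +-suc u u = trans (cong suc (ix-even u)) (sym (+-suc a u))

    ix-odd : ∀ u → ix (suc (u + u)) ≡ α + u
    ix-odd zero    = sym (+-identityʳ α)
    ix-odd (suc u) rewrite +-suc u u = trans (cong suc (ix-odd u)) (sym (+-suc α u))

    α+u<a : ∀ {u} → u < n → α + u < a
    α+u<a u<n = subst (_ <_) α+n≡a (+-monoʳ-< α u<n)

    odd-< : ∀ u → suc (u + u) < K → u < n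
    odd-< _ = m+m<n+n⇒m<n ∘ <-trans (n<1+n _)

    ix-<m : ∀ {t} → t < K → ix t < m
    ix-<m {t} t<K with half t
    ... | even u = subst (_< m) (sym (ix-even u)) (+-monoʳ-< a (<-≤-trans (m+m<n+n⇒m<n t<K) n≤b))
    ... | odd u  = subst (_< m) (sym (ix-odd u)) (<-≤-trans (α+u<a (odd-< u t<K)) (m≤m+n a b))

    ix-even≢ix-odd : ∀ u u' → u' < n → ix (u + u) ≢ ix (suc (u' + u'))
    ix-even≢ix-odd u u' u'<n e =
      <⇒≢ (<-≤-trans (α+u<a u'<n) (m≤m+n a u)) (trans (sym (ix-odd u')) (trans (sym e) (ix-even u)))

    ix-injective : InjectiveBelow K ix
    ix-injective t t' t<K t'<K e with half t | half t'
    ... | even u | even u' =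
      cong (λ v → v + v) (+-cancelˡ-≡ a u u' (trans (sym (ix-even u)) (trans e (ix-even u'))))
    ... | odd u  | odd u'  =
      cong (λ v → suc (v + v)) (+-cancelˡ-≡ α u u' (trans (sym (ix-odd u)) (trans e (ix-odd u'))))
    ... | even u | odd u'  = contradiction e (ix-even≢ix-odd u u' (odd-< u' t'<K))
    ... | odd u  | even u' = contradiction (sym e) (ix-even≢ix-odd u' u (odd-< u t<K))

    c : ℕ → ℕ
    c = g ∘ ix

    c-injective : InjectiveBelow K c
    c-injective t t' t<K t'<K =
      ix-injective t t' t<K t'<K ∘ g-injective (ix t) (ix t') (ix-<m t<K) (ix-<m t'<K)

    BlueEnds : Edge → Set
    BlueEnds e = ∀ {B} → B₀ ⊆ B → Coloured B blue e → Ended K j B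

    BlueEnds-swap : ∀ {u v} → BlueEnds (u , v) → BlueEnds (v , u)
    BlueEnds-swap ends B₀⊆B = ends B₀⊆B ∘ HasColour-sym

    bridgeEnds : ∀ {u v} → u < n → v < b → v ≤ suc u → BlueEnds (g (α + u) , g (a + v))
    bridgeEnds {u} {v} u<n v<b v≤1+u {B} B₀⊆B blueEdge with m≤n⇒∃[o]m+o≡n u<n
    ... | w , 1+u+w≡n =
      inj₂ (skipPath B₀⊆B (α+u<a u<n) (subst (a ≤_) a+v≡r (m≤m+n a v)) j+D≤m
                     (subst (λ r → HasColour B (g (α + u)) (g r) blue) a+v≡r blueEdge))
      where
      arith : ∀ α u v w → α + (suc u + w) + v ≡ suc (α + u + (v + w))
      arith = solve-∀
      a+v≡r : a + v ≡ suc (α + u + (v + w))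
      a+v≡r = begin
        a + v                  ≡⟨ cong (_+ v) (sym α+n≡a) ⟩
        α + n + v              ≡⟨ cong (λ n → α + n + v) (sym 1+u+w≡n) ⟩
        α + (suc u + w) + v    ≡⟨ arith α u v w ⟩
        suc (α + u + (v + w))  ∎
        where open ≡-Reasoning
      j+D≤m : j + (v + w) ≤ m
      j+D≤m = ≤-trans (+-monoʳ-≤ j (subst (v + w ≤_) 1+u+w≡n (+-monoˡ-≤ w v≤1+u)))
                      (≤-reflexive (m∸n+n≡m (≤-trans n≤b (m≤n+m b a))))

    pathEnds : ∀ i → suc i < K → BlueEnds (c i , c (suc i))
    pathEnds i 1+i<K with half i
    ... | even u rewrite ix-even u | ix-odd u =
      BlueEnds-swap (bridgeEnds (odd-< u 1+i<K) (<-≤-trans (odd-< u 1+i<K) n≤b) (n≤1+n u))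
    ... | odd u rewrite ix-odd u | ix-even u =
      subst (λ r → BlueEnds (g (α + u) , g r)) (+-suc a u)
        (bridgeEnds (<-trans (n<1+n u) 1+u<n) (<-≤-trans 1+u<n n≤b) ≤-refl)
      where
      1+u<n : suc u < n
      1+u<n = m+m<n+n⇒m<n (subst (_< K) (sym (cong suc (+-suc u u))) 1+i<K)

    closingEnds : BlueEnds (c (K ∸ 1) , c 0)
    closingEnds = subst₂ (λ x y → BlueEnds (g x , g y)) (sym last) (+-identityʳ a)
                    (bridgeEnds ≤-refl (<-≤-trans (s≤s z≤n) n≤b) z≤n)
      where
      last : ix (n' + n) ≡ α + n'
      last = trans (cong ix (+-suc n' n')) (ix-odd n')

    zigzagWins : WinsWithin K j K B₀
    zigzagWins = forceRedCycle c (s≤s (≤-trans (s≤s z≤n) (m≤n+m n n'))) c-injective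
                   (All-cycleEdges⁺ c closingEnds pathEnds)

  wins : ∀ n → 1 ≤ n → WinsWithin (n + n) (m ∸ n) (n + n) B₀
  wins n@(suc n') _ with n ≤? a | n ≤? b
  ... | no n≰a  | _       = done (inj₂ (suffixPath m∸n≤b))
    where
    m∸n≤b : m ∸ n ≤ b
    m∸n≤b = ≤-trans (∸-monoʳ-≤ m (<⇒≤ (≰⇒> n≰a))) (≤-reflexive (m+n∸m≡n a b))
  ... | _       | no n≰b  = done (inj₂ (prefixPath m∸n≤a))
    where
    m∸n≤a : m ∸ n ≤ a
    m∸n≤a = ≤-trans (∸-monoʳ-≤ m (<⇒≤ (≰⇒> n≰b))) (≤-reflexive (m+n∸n≡m a b))
  ... | yes n≤a | yes n≤b = Zigzag.zigzagWins (a ∸ n) n' (m∸n+n≡m n≤a) n≤b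

lemma9 : (k m : ℕ) → 4 ≤ k → k % 2 ≡ 0 → k / 2 < m →
         (xs ys : List ℕ) → xs ≢ [] → ys ≢ [] →
         Unique (xs ++ ys) → length xs + length ys ≡ m →
         WinsWithin k (m ∸ k / 2) k (bluePathEdges xs ++ bluePathEdges ys)
lemma9 k m 4≤k k-even _ xs ys _ _ uniq a+b≡m =
  subst₂ (λ K M → WinsWithin K (M ∸ k / 2) K (bluePathEdges xs ++ bluePathEdges ys))
         (sym k≡n+n) a+b≡m
    (TwoPaths.wins xs ys uniq (k / 2) (m≥n⇒m/n>0 (≤-trans (s≤s (s≤s z≤n)) 4≤k)))
  where
  open ≡-Reasoning
  k≡n+n : k ≡ k / 2 + k / 2
  k≡n+n = begin
    k                      ≡⟨ m≡m%n+[m/n]*n k 2 ⟩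
    k % 2 + k / 2 * 2      ≡⟨ cong (_+ k / 2 * 2) k-even ⟩
    k / 2 * 2              ≡⟨ *-comm (k / 2) 2 ⟩
    k / 2 + (k / 2 + 0)    ≡⟨ cong (k / 2 +_) (+-identityʳ (k / 2)) ⟩
    k / 2 + k / 2          ∎
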